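{- Let $G=(V,E)$ be a trivalent $2$-edge-connected graph. Every cyclic subset $A\subseteq V$ is dependent in $M_G$.
   Context: Graphs are finite and undirected and may have parallel edges; trivalent means every vertex has degree $3$. A set $\{v_1,\dots,v_r\}$ of distinct vertices is a cycle if, after relabeling, $v_i$ and $v_{i+1}$ are adjacent for all $i$, where $v_{r+1}=v_1$. A vertex subset is cyclic if its induced subgraph contains a cycle. $r^*$ is the rank function of the bond (cographic) matroid of $G$. For $A\subseteq V$, $\delta(A)$ is the set of edges incident to at least one vertex of $A$. The graph curve matroid $M_G$ is the matroid on $V$ whose circuits are the non-empty subsets $A\subseteq V$ that are inclusion-minimal among non-empty subsets satisfying $r^*(\delta(A))\le|A|$. -}

module Defs where

open import Data.Nat using (ℕ; zero; suc; _+_; _≤_)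
open import Data.Fin using (Fin; zero; suc; fromℕ; inject₁; _≟_)
open import Data.Fin.Subset using (Subset; _∈_; _⊆_; ∁; ⊤; ∣_∣; Nonempty)
open import Data.Vec using (tabulate; lookup)
open import Data.Bool using (_∨_)
open import Data.List using (List; map; allFin)
open import Data.Nat.ListAction using (sum)
open import Data.Product using (_×_; _,_; proj₁; proj₂; Σ; ∃)
open import Data.Sum using (_⊎_)
open import Relation.Binary.PropositionalEquality using (_≡_)
open import Relation.Nullary.Decidable using (isYes)
open import Function.Definitions using (Injective)

-- A finite undirected multigraph: vertices Fin n, edges Fin m,
-- each edge has an (unordered, stored as a pair) set of two endpoints.
record Graph : Set where
  field
    n    : ℕ
    m    : ℕ
    ends : Fin m → Fin n × Fin n

module _ (G : Graph) where
  open Graph G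

  V = Fin n
  E = Fin m

  Joins : E → V → V → Set
  Joins e u v = (ends e ≡ (u , v)) ⊎ (ends e ≡ (v , u))

  -- degree of v (a loop would count twice)
  [_] : Data.Bool.Bool → ℕ
  [ Data.Bool.true ]  = 1
  [ Data.Bool.false ] = 0

  degree : V → ℕ
  degree v = sum (map (λ e → [ isYes (proj₁ (ends e) ≟ v) ] + [ isYes (proj₂ (ends e) ≟ v) ]) (allFin m))

  Trivalent : Set
  Trivalent = ∀ v → degree v ≡ 3

  data Reach (S : Subset m) : V → V → Set where
    here : ∀ {u} → Reach S u u
    step : ∀ {u w v} (e : E) → e ∈ S → Joins e u w → Reach S w v → Reach S u v

  ConnectedOn : Subset m → Set
  ConnectedOn S = ∀ u v → Reach S u v

  TwoEdgeConnected : Set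
  TwoEdgeConnected = ConnectedOn ⊤ × (∀ (e : E) → ConnectedOn (∁ (tabulate (λ f → isYes (f ≟ e)))))

  -- independent sets of the bond (cographic) matroid M*(G):
  -- I is independent iff E \ I contains a basis of the cycle matroid, i.e.
  -- deleting I does not change the connectivity relation of G.
  BondIndependent : Subset m → Set
  BondIndependent I = ∀ u v → Reach ⊤ u v → Reach (∁ I) u v

  -- r*(F) ≤ k, where r*(F) = max { |I| : I ⊆ F, I independent in M*(G) }
  BondRank≤ : Subset m → ℕ → Set
  BondRank≤ F k = ∀ (I : Subset m) → I ⊆ F → BondIndependent I → ∣ I ∣ ≤ k

  δ : Subset n → Subset m
  δ A = tabulate (λ e → lookup A (proj₁ (ends e)) ∨ lookup A (proj₂ (ends e)))

  Small : Subset n → Set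
  Small A = BondRank≤ (δ A) ∣ A ∣

  -- circuits of the graph curve matroid M_G
  Circuit : Subset n → Set
  Circuit A = Nonempty A × Small A × (∀ B → Nonempty B → B ⊆ A → Small B → B ≡ A)

  Dependent : Subset n → Set
  Dependent A = ∃ λ C → C ⊆ A × Circuit C

  record CycleIn (A : Subset n) : Set where
    field
      k     : ℕ
      vs    : Fin (suc k) → V
      es    : Fin (suc k) → E
      vs-inj : Injective _≡_ _≡_ vs
      es-inj : Injective _≡_ _≡_ es
      vs∈A  : ∀ i → vs i ∈ A
      joins : ∀ (i : Fin k) → Joins (es (inject₁ i)) (vs (inject₁ i)) (vs (suc i))
      close : Joins (es (fromℕ k)) (vs (fromℕ k)) (vs zero)

  Cyclic : Subset n → Set
  Cyclic A = CycleIn A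

-- Let C be the vertex set of the cycle, so |C| ≤ |E[C]|, where E[C] is the set of edges with
-- both ends in C. For a bond-independent I ⊆ δ(C) the complement F = E ∖ I is a connected
-- spanning edge set, and such an F satisfies |F ∩ δ(X)| ≥ |X| for every X missing some vertex:
-- repeatedly delete from X the X-end of an edge of F leaving X. Counting degrees gives
-- |δ(C)| + |E[C]| = 3|C|, and |δ(C)| = |I| + |F ∩ δ(C)|. If C ≠ V this yields
-- |I| ≤ 3|C| − |C| − |C|; if C = V then δ(C) = E[C] = E, 2|E| = 3|C| and |F| ≥ |C| − 1, so
-- again |I| ≤ |C|. Hence r*(δ(C)) ≤ |C|, and since this property is decidable, C contains an
-- inclusion-minimal nonempty set with it, that is, a circuit.
module Submission where

open import Defs
open import Data.Bool using (Bool; true; false; _∧_; _∨_)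
import Data.Bool.Properties as Bool
open import Data.Fin using (Fin; zero; suc; _≟_)
open import Data.Fin.Properties using (any?; all?; ¬∀⟶∃¬; suc-injective)
open import Data.Fin.Relation.Unary.Top using (view; ‵fromℕ; ‵inject₁)
open import Data.Fin.Subset
  using (Subset; _∈_; _∉_; _⊆_; _⊂_; _⊄_; _∩_; _∪_; _-_; ∁; ⁅_⁆; ⊤; ∣_∣; Nonempty; Empty)
open import Data.Fin.Subset.Induction using (⊂-wellFounded)
open import Data.Fin.Subset.Properties
  using ( _∈?_; _⊆?_; _⊂?_; nonempty?; anySubset?; ⊆-trans; ⊆-antisym; drop-∷-⊆
        ; x∈⁅x⁆; x∈⁅y⁆⇒x≡y; x∈p∩q⁺; x∈p∩q⁻; x∈p∪q⁻; p⊆p∪q; q⊆p∪q; p─q⊆p; p─⊥≡p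
        ; x∈p∧x≢y⇒x∈p-y; x∈p⇒p-x⊂p; x∈p⇒∣p-x∣<∣p∣; p⊆q⇒∣p∣≤∣q∣; p⊂q⇒∣p∣<∣q∣
        ; ∣p∣≤n; Empty-unique; ∣⊥∣≡0)
import Data.List as List using (map; tabulate)
open import Data.Nat using (ℕ; zero; suc; _+_; _*_; _≤_; _<_; z≤n; s≤s; s≤s⁻¹; _≤?_)
open import Data.Nat.GeneralisedArithmetic using (fold)
import Data.Nat.ListAction as List using (sum)
open import Data.Nat.Properties
  using ( ≤-reflexive; ≤-trans; <⇒≱; <⇒≢; ≰⇒>; m≤n⇒m≤1+n; m≤m+n
        ; +-assoc; +-comm; +-suc; +-identityʳ; *-comm; *-identityʳ; *-zeroʳ; *-distribˡ-+
        ; +-mono-≤; +-monoˡ-≤; +-monoʳ-≤; +-monoʳ-<; +-cancelʳ-≤; +-*-semiring; module ≤-Reasoning)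
open import Algebra.Properties.Semiring.Sum +-*-semiring
  using (sum-syntax; sum-cong-≗; sum-replicate-zero; ∑-comm; ∑-distrib-+; *-distribˡ-sum; *-distribʳ-sum)
import Data.Product.Properties as Product
open import Data.Product using (_×_; _,_; proj₁; proj₂; ∃; ∃₂; uncurry)
open import Data.Sum using (_⊎_; inj₁; inj₂; swap)
import Data.Sum as Sum
open import Data.Vec using (_∷_; []; lookup; tabulate; here; there)
open import Data.Vec.Properties using (lookup∘tabulate; lookup⇒[]=; []=⇒lookup)
open import Function using (id; _∘_; case_of_)
open import Function.Definitions using (Injective)
open import Induction.WellFounded using (Acc; acc)
open import Relation.Binary.PropositionalEquality using (_≡_; refl; sym; trans; cong; cong₂; subst; module ≡-Reasoning)
open import Relation.Nullary using (Dec; yes; no; does; contradiction)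
open import Relation.Nullary.Decidable
  using (isYes; map′; decidable-stable; dec-true; ¬?; _×-dec_; _⊎-dec_; _→-dec_)
open import Relation.Unary using (Pred; Decidable)

χ : Bool → ℕ
χ true  = 1
χ false = 0

χa+χb≡χ[a∨b]+χ[a∧b] : ∀ a b → χ a + χ b ≡ χ (a ∨ b) + χ (a ∧ b)
χa+χb≡χ[a∨b]+χ[a∧b] true  true  = refl
χa+χb≡χ[a∨b]+χ[a∧b] true  false = refl
χa+χb≡χ[a∨b]+χ[a∧b] false true  = refl
χa+χb≡χ[a∨b]+χ[a∧b] false false = refl

-- Phrased with does: does (suc a ≟ suc v) reduces to does (a ≟ v), whereas isYes does not.
∑-select : ∀ {n} (f : Fin n → ℕ) a → ∑[ v < n ] (f v * χ (does (a ≟ v))) ≡ f a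
∑-select {suc n} f zero = begin
  f zero * 1 + ∑[ v < n ] (f (suc v) * 0) ≡⟨ cong₂ _+_ (*-identityʳ (f zero)) ∑0≡0 ⟩
  f zero + 0                              ≡⟨ +-identityʳ (f zero) ⟩
  f zero                                  ∎
  where
  open ≡-Reasoning
  ∑0≡0 : ∑[ v < n ] (f (suc v) * 0) ≡ 0
  ∑0≡0 = trans (sum-cong-≗ (λ v → *-zeroʳ (f (suc v)))) (sum-replicate-zero n)
∑-select {suc n} f (suc a) = cong₂ _+_ (*-zeroʳ (f zero)) (∑-select {n} (f ∘ suc) a)

sum-map-tabulate : ∀ {m} {A : Set} (h : A → ℕ) (g : Fin m → A) →
  List.sum (List.map h (List.tabulate g)) ≡ ∑[ i < m ] h (g i)
sum-map-tabulate {zero}  h g = refl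
sum-map-tabulate {suc m} h g = cong (h (g zero) +_) (sum-map-tabulate h (g ∘ suc))

module _ {n : ℕ} where

  ∈-tabulate⁺ : ∀ {f : Fin n → Bool} {i} → f i ≡ true → i ∈ tabulate f
  ∈-tabulate⁺ {f} {i} fi≡true = lookup⇒[]= i (tabulate f) (trans (lookup∘tabulate f i) fi≡true)

  ∈-tabulate⁻ : ∀ {f : Fin n → Bool} {i} → i ∈ tabulate f → f i ≡ true
  ∈-tabulate⁻ {f} {i} i∈ = trans (sym (lookup∘tabulate f i)) ([]=⇒lookup i∈)

  module _ {p} {P : Pred (Fin n) p} (P? : Decidable P) where

    ∈-tabulate-does⁺ : ∀ {i} → P i → i ∈ tabulate (does ∘ P?)
    ∈-tabulate-does⁺ {i} Pi = ∈-tabulate⁺ (dec-true (P? i) Pi)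

    ∈-tabulate-does⁻ : ∀ {i} → i ∈ tabulate (does ∘ P?) → P i
    ∈-tabulate-does⁻ {i} i∈ with P? i | ∈-tabulate⁻ {f = does ∘ P?} i∈
    ... | yes Pi | _  = Pi
    ... | no  _  | ()

∣p∣≡∑χ : ∀ {n} (p : Subset n) → ∣ p ∣ ≡ ∑[ i < n ] χ (lookup p i)
∣p∣≡∑χ []          = refl
∣p∣≡∑χ (true  ∷ p) = cong suc (∣p∣≡∑χ p)
∣p∣≡∑χ (false ∷ p) = ∣p∣≡∑χ p

∣tabulate∣≡∑χ : ∀ {n} (f : Fin n → Bool) → ∣ tabulate f ∣ ≡ ∑[ i < n ] χ (f i)
∣tabulate∣≡∑χ f = trans (∣p∣≡∑χ (tabulate f)) (sum-cong-≗ (cong χ ∘ lookup∘tabulate f))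

∣p∣≤1+∣p-x∣ : ∀ {n} (p : Subset n) x → ∣ p ∣ ≤ suc ∣ p - x ∣
∣p∣≤1+∣p-x∣ (true  ∷ p) zero    = s≤s (≤-reflexive (cong ∣_∣ (sym (p─⊥≡p p))))
∣p∣≤1+∣p-x∣ (false ∷ p) zero    = m≤n⇒m≤1+n (≤-reflexive (cong ∣_∣ (sym (p─⊥≡p p))))
∣p∣≤1+∣p-x∣ (true  ∷ p) (suc x) = s≤s (∣p∣≤1+∣p-x∣ p x)
∣p∣≤1+∣p-x∣ (false ∷ p) (suc x) = ∣p∣≤1+∣p-x∣ p x

x∉p-x : ∀ {n} (p : Subset n) x → x ∉ p - x
x∉p-x (_ ∷ p) zero    ()
x∉p-x (_ ∷ p) (suc x) (there x∈p-x) = x∉p-x p x x∈p-x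

∩-monoʳ-⊆ : ∀ {n} (p : Subset n) {q r} → q ⊆ r → p ∩ q ⊆ p ∩ r
∩-monoʳ-⊆ p {q} q⊆r x∈p∩q with x∈p∩q⁻ p q x∈p∩q
... | x∈p , x∈q = x∈p∩q⁺ (x∈p , q⊆r x∈q)

⊆⇒∣p∣+∣∁p∩q∣≡∣q∣ : ∀ {n} {p q : Subset n} → p ⊆ q → ∣ p ∣ + ∣ ∁ p ∩ q ∣ ≡ ∣ q ∣
⊆⇒∣p∣+∣∁p∩q∣≡∣q∣ {p = []}        {[]}        _   = refl
⊆⇒∣p∣+∣∁p∩q∣≡∣q∣ {p = true  ∷ p} {true  ∷ q} p⊆q = cong suc (⊆⇒∣p∣+∣∁p∩q∣≡∣q∣ (drop-∷-⊆ p⊆q))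
⊆⇒∣p∣+∣∁p∩q∣≡∣q∣ {p = true  ∷ p} {false ∷ q} p⊆q with () ← p⊆q here
⊆⇒∣p∣+∣∁p∩q∣≡∣q∣ {p = false ∷ p} {true  ∷ q} p⊆q =
  trans (+-suc ∣ p ∣ _) (cong suc (⊆⇒∣p∣+∣∁p∩q∣≡∣q∣ (drop-∷-⊆ p⊆q)))
⊆⇒∣p∣+∣∁p∩q∣≡∣q∣ {p = false ∷ p} {false ∷ q} p⊆q = ⊆⇒∣p∣+∣∁p∩q∣≡∣q∣ (drop-∷-⊆ p⊆q)

p⊆q∧p⊄q⇒p≡q : ∀ {n} {p q : Subset n} → p ⊆ q → p ⊄ q → p ≡ q
p⊆q∧p⊄q⇒p≡q {p = p} p⊆q p⊄q = ⊆-antisym p⊆q λ {x} x∈q →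
  decidable-stable (x ∈? p) λ x∉p → p⊄q (p⊆q , x , x∈q , x∉p)

allSubset? : ∀ {n ℓ} {P : Pred (Subset n) ℓ} → Decidable P → Dec (∀ p → P p)
allSubset? P? = map′ (λ ∄¬P p → decidable-stable (P? p) (λ ¬Pp → ∄¬P (p , ¬Pp)))
                     (λ ∀P (p , ¬Pp) → ¬Pp (∀P p))
                     (¬? (anySubset? (¬? ∘ P?)))

module _ {n : ℕ} {ℓ} {P : Pred (Subset n) ℓ} (P? : Decidable P) where

  ∃-minimal⊆ : ∀ {A} → Nonempty A → P A →
    ∃ λ C → C ⊆ A × (Nonempty C × P C × (∀ B → Nonempty B → B ⊆ C → P B → B ≡ C))
  ∃-minimal⊆ = go (⊂-wellFounded _)
    where
    go : ∀ {A} → Acc _⊂_ A → Nonempty A → P A →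
      ∃ λ C → C ⊆ A × (Nonempty C × P C × (∀ B → Nonempty B → B ⊆ C → P B → B ≡ C))
    go {A} (acc smaller) A≢∅ PA with anySubset? (λ B → nonempty? B ×-dec (B ⊂? A ×-dec P? B))
    ... | yes (B , B≢∅ , B⊂A , PB) =
      let C , C⊆B , C-minimal = go (smaller B⊂A) B≢∅ PB in C , ⊆-trans C⊆B (proj₁ B⊂A) , C-minimal
    ... | no ∄B = A , id , A≢∅ , PA ,
      λ B B≢∅ B⊆A PB → p⊆q∧p⊄q⇒p≡q B⊆A λ B⊂A → ∄B (B , B≢∅ , B⊂A , PB)

module _ {n : ℕ} (f : Subset n → Subset n) (inflationary : ∀ p → p ⊆ f p) where

  fold-stabilises : ∀ p → ∃ λ t → f (fold p f t) ≡ fold p f t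
  fold-stabilises p with fixed-or-growing (suc n)
    where
    fixed-or-growing : ∀ t → (∃ λ s → f (fold p f s) ≡ fold p f s) ⊎ t ≤ ∣ fold p f t ∣
    fixed-or-growing zero = inj₂ z≤n
    fixed-or-growing (suc t) with fixed-or-growing t
    ... | inj₁ fixed = inj₁ fixed
    ... | inj₂ t≤∣pₜ∣ with fold p f t ⊂? f (fold p f t)
    ...   | yes pₜ⊂fpₜ = inj₂ (≤-trans (s≤s t≤∣pₜ∣) (p⊂q⇒∣p∣<∣q∣ pₜ⊂fpₜ))
    ...   | no  pₜ⊄fpₜ = inj₁ (t , sym (p⊆q∧p⊄q⇒p≡q (inflationary _) pₜ⊄fpₜ))
  ... | inj₁ fixed    = fixed
  ... | inj₂ n<∣pₙ∣ = contradiction (∣p∣≤n (fold p f (suc n))) (<⇒≱ n<∣pₙ∣)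

image : ∀ {k n} → (Fin k → Fin n) → Subset n
image g = tabulate (does ∘ λ v → any? λ i → g i ≟ v)

∈-image : ∀ {k n} (g : Fin k → Fin n) i → g i ∈ image g
∈-image g i = ∈-tabulate-does⁺ (λ v → any? λ j → g j ≟ v) (i , refl)

∈-image⁻ : ∀ {k n} (g : Fin k → Fin n) {v} → v ∈ image g → ∃ λ i → g i ≡ v
∈-image⁻ g = ∈-tabulate-does⁻ (λ v → any? λ i → g i ≟ v)

∣image∣≤ : ∀ {k n} (g : Fin k → Fin n) → ∣ image g ∣ ≤ k
∣image∣≤ {zero} {n} g = ≤-reflexive (trans (cong ∣_∣ (Empty-unique image-empty)) (∣⊥∣≡0 n))
  where
  image-empty : Empty (image g)
  image-empty (_ , v∈) with () ← proj₁ (∈-image⁻ g v∈)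
∣image∣≤ {suc k} g = begin
  ∣ image g ∣              ≤⟨ ∣p∣≤1+∣p-x∣ (image g) (g zero) ⟩
  suc ∣ image g - g zero ∣ ≤⟨ s≤s (p⊆q⇒∣p∣≤∣q∣ rest⊆image-tail) ⟩
  suc ∣ image (g ∘ suc) ∣  ≤⟨ s≤s (∣image∣≤ (g ∘ suc)) ⟩
  suc k                    ∎
  where
  open ≤-Reasoning
  rest⊆image-tail : image g - g zero ⊆ image (g ∘ suc)
  rest⊆image-tail v∈ with ∈-image⁻ g (p─q⊆p _ _ v∈)
  ... | zero  , refl = contradiction v∈ (x∉p-x _ _)
  ... | suc i , refl = ∈-image (g ∘ suc) i

injective⇒≤∣p∣ : ∀ {k n} {g : Fin k → Fin n} {p} → Injective _≡_ _≡_ g → (∀ i → g i ∈ p) → k ≤ ∣ p ∣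
injective⇒≤∣p∣ {zero}              _   _   = z≤n
injective⇒≤∣p∣ {suc k} {g = g} {p} inj g∈p = begin
  suc k              ≤⟨ s≤s (injective⇒≤∣p∣ (suc-injective ∘ inj) g∘suc∈p-g0) ⟩
  suc ∣ p - g zero ∣ ≤⟨ x∈p⇒∣p-x∣<∣p∣ (g∈p zero) ⟩
  ∣ p ∣              ∎
  where
  open ≤-Reasoning
  g∘suc∈p-g0 : ∀ i → g (suc i) ∈ p - g zero
  g∘suc∈p-g0 i = x∈p∧x≢y⇒x∈p-y (g∈p (suc i)) λ eq → case inj eq of λ ()

s+f+t≡3r∧r≤f∧r≤t⇒s≤r : ∀ {s f t r} → s + f + t ≡ r * 3 → r ≤ f → r ≤ t → s ≤ r
s+f+t≡3r∧r≤f∧r≤t⇒s≤r {s} {f} {t} {r} s+f+t≡3r r≤f r≤t = +-cancelʳ-≤ (r + r) s r (begin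
  s + (r + r)       ≤⟨ +-monoʳ-≤ s (+-mono-≤ r≤f r≤t) ⟩
  s + (f + t)       ≡⟨ sym (+-assoc s f t) ⟩
  s + f + t         ≡⟨ s+f+t≡3r ⟩
  r * 3             ≡⟨ *-comm r 3 ⟩
  r + (r + (r + 0)) ≡⟨ cong (λ x → r + (r + x)) (+-identityʳ r) ⟩
  r + (r + r)       ∎)
  where open ≤-Reasoning

s+f≡d∧d+d≡3r∧r≤1+f⇒s≤r : ∀ {s f d r} → s + f ≡ d → d + d ≡ r * 3 → r ≤ suc f → s ≤ r
s+f≡d∧d+d≡3r∧r≤1+f⇒s≤r {s} {f} {d} {r} s+f≡d d+d≡3r r≤1+f with s ≤? r
... | yes s≤r = s≤r
... | no  s≰r = contradiction (sym d+d≡3r) (<⇒≢ 3r<d+d)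
  where
  open ≤-Reasoning
  r<s : r < s
  r<s = ≰⇒> s≰r
  r<d : r < d
  r<d = ≤-trans r<s (≤-trans (m≤m+n s f) (≤-reflexive s+f≡d))
  r+r≤d : r + r ≤ d
  r+r≤d = s≤s⁻¹ (begin
    suc r + r   ≤⟨ +-mono-≤ r<s r≤1+f ⟩
    s + suc f   ≡⟨ +-suc s f ⟩
    suc (s + f) ≡⟨ cong suc s+f≡d ⟩
    suc d       ∎)
  3r<d+d : r * 3 < d + d
  3r<d+d = begin-strict
    r * 3             ≡⟨ *-comm r 3 ⟩
    r + (r + (r + 0)) ≡⟨ cong (λ x → r + (r + x)) (+-identityʳ r) ⟩
    r + (r + r)       ≡⟨ +-comm r (r + r) ⟩
    r + r + r         <⟨ +-monoʳ-< (r + r) r<d ⟩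
    r + r + d         ≤⟨ +-monoˡ-≤ d r+r≤d ⟩
    d + d             ∎

module _ (G : Graph) where

  open Graph G

  end₁ end₂ : Fin m → Fin n
  end₁ e = proj₁ (ends e)
  end₂ e = proj₂ (ends e)

  E[_] : Subset n → Subset m
  E[ X ] = tabulate λ e → lookup X (end₁ e) ∧ lookup X (end₂ e)

  joins-ends : ∀ {e u w} → Joins G e u w → (u ≡ end₁ e × w ≡ end₂ e) ⊎ (u ≡ end₂ e × w ≡ end₁ e)
  joins-ends (inj₁ refl) = inj₁ (refl , refl)
  joins-ends (inj₂ refl) = inj₂ (refl , refl)

  reach-extend : ∀ {S u w v e} → Reach G S u w → e ∈ S → Joins G e w v → Reach G S u v
  reach-extend here                  e∈S w─v = step _ e∈S w─v here
  reach-extend (step f f∈S u─x x⇝w) e∈S w─v = step f f∈S u─x (reach-extend x⇝w e∈S w─v)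

  exit-edge : ∀ {F X x y} → Reach G F x y → x ∈ X → y ∉ X →
    ∃ λ e → e ∈ F × ∃₂ λ a b → a ∈ X × b ∉ X × Joins G e a b
  exit-edge here x∈X x∉X = contradiction x∈X x∉X
  exit-edge {X = X} (step {w = w} e e∈F x─w w⇝y) x∈X y∉X with w ∈? X
  ... | yes w∈X = exit-edge w⇝y w∈X y∉X
  ... | no  w∉X = e , e∈F , _ , w , x∈X , w∉X , x─w

  module _ {ℓ} {P : Fin n → Set ℓ} where

    joins-⊎ : ∀ {e u w} → Joins G e u w → P u ⊎ P w → P (end₁ e) ⊎ P (end₂ e)
    joins-⊎ u─w with joins-ends u─w
    ... | inj₁ (refl , refl) = id
    ... | inj₂ (refl , refl) = swap

    joins-× : ∀ {e u w} → Joins G e u w → P u → P w → P (end₁ e) × P (end₂ e)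
    joins-× u─w Pu Pw with joins-ends u─w
    ... | inj₁ (refl , refl) = Pu , Pw
    ... | inj₂ (refl , refl) = Pw , Pu

  ∈δ⁺ : ∀ {X e} → end₁ e ∈ X ⊎ end₂ e ∈ X → e ∈ δ G X
  ∈δ⁺ {X} {e} (inj₁ e₁∈X) = ∈-tabulate⁺ (cong (_∨ lookup X (end₂ e)) ([]=⇒lookup e₁∈X))
  ∈δ⁺ {X} {e} (inj₂ e₂∈X) = ∈-tabulate⁺ (trans (cong (lookup X (end₁ e) ∨_) ([]=⇒lookup e₂∈X)) (Bool.∨-zeroʳ _))

  ∈δ⁻ : ∀ {X e} → e ∈ δ G X → end₁ e ∈ X ⊎ end₂ e ∈ X
  ∈δ⁻ {X} {e} e∈δX with lookup X (end₁ e) in e₁∈X | ∈-tabulate⁻ e∈δX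
  ... | true  | _      = inj₁ (lookup⇒[]= _ X e₁∈X)
  ... | false | e₂∈X   = inj₂ (lookup⇒[]= _ X e₂∈X)

  ∈E[]⁺ : ∀ {X e} → end₁ e ∈ X → end₂ e ∈ X → e ∈ E[ X ]
  ∈E[]⁺ e₁∈X e₂∈X = ∈-tabulate⁺ (cong₂ _∧_ ([]=⇒lookup e₁∈X) ([]=⇒lookup e₂∈X))

  ∈E[]⁻ : ∀ {X e} → e ∈ E[ X ] → end₁ e ∈ X × end₂ e ∈ X
  ∈E[]⁻ {X} {e} e∈E[X] with lookup X (end₁ e) in e₁∈X | lookup X (end₂ e) in e₂∈X | ∈-tabulate⁻ e∈E[X]
  ... | true | true | _ = lookup⇒[]= _ X e₁∈X , lookup⇒[]= _ X e₂∈X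

  E[]⊆δ : ∀ {X} → E[ X ] ⊆ δ G X
  E[]⊆δ {X} = ∈δ⁺ {X} ∘ inj₁ ∘ proj₁ ∘ ∈E[]⁻ {X}

  δ-mono : ∀ {X Y} → X ⊆ Y → δ G X ⊆ δ G Y
  δ-mono {X} {Y} X⊆Y = ∈δ⁺ {Y} ∘ Sum.map X⊆Y X⊆Y ∘ ∈δ⁻ {X}

  Neighbour : Subset m → Subset n → Fin n → Set
  Neighbour S R w = ∃ λ e → e ∈ S × ∃ λ u → u ∈ R × Joins G e u w

  joins? : ∀ e u w → Dec (Joins G e u w)
  joins? e u w = ends e ≟² (u , w) ⊎-dec ends e ≟² (w , u)
    where _≟²_ = Product.≡-dec _≟_ _≟_

  neighbour? : ∀ S R w → Dec (Neighbour S R w)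
  neighbour? S R w = any? λ e → e ∈? S ×-dec any? λ u → u ∈? R ×-dec joins? e u w

  expand : Subset m → Subset n → Subset n
  expand S R = R ∪ tabulate (does ∘ neighbour? S R)

  ball : Subset m → Fin n → ℕ → Subset n
  ball S u = fold ⁅ u ⁆ (expand S)

  ∈ball : ∀ {S} u t → u ∈ ball S u t
  ∈ball u zero    = x∈⁅x⁆ u
  ∈ball u (suc t) = p⊆p∪q _ (∈ball u t)

  ball-sound : ∀ {S u v} t → v ∈ ball S u t → Reach G S u v
  ball-sound {u = u} zero v∈⁅u⁆ rewrite x∈⁅y⁆⇒x≡y u v∈⁅u⁆ = here
  ball-sound {S} {u} (suc t) v∈ with x∈p∪q⁻ (ball S u t) _ v∈
  ... | inj₁ v∈ballₜ = ball-sound t v∈ballₜ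
  ... | inj₂ v∈next  with ∈-tabulate-does⁻ (neighbour? S (ball S u t)) v∈next
  ...   | e , e∈S , w , w∈ballₜ , w─v = reach-extend (ball-sound t w∈ballₜ) e∈S w─v

  expand-closed : ∀ {S R x v} → expand S R ≡ R → x ∈ R → Reach G S x v → v ∈ R
  expand-closed fixed x∈R here = x∈R
  expand-closed {S} {R} fixed x∈R (step {w = w} e e∈S x─w w⇝v) =
    expand-closed fixed (subst (w ∈_) fixed (q⊆p∪q R _ (∈-tabulate-does⁺ (neighbour? S R) (e , e∈S , _ , x∈R , x─w)))) w⇝v

  -- Breadth-first search: the balls around u grow until they are stable, and a stable ball
  -- is closed under walks.
  reach? : ∀ S u v → Dec (Reach G S u v)
  reach? S u v with fold-stabilises (expand S) (λ R → p⊆p∪q _) ⁅ u ⁆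
  ... | t , fixed = map′ (ball-sound t) (expand-closed fixed (∈ball u t)) (v ∈? ball S u t)

  bondIndependent? : ∀ I → Dec (BondIndependent G I)
  bondIndependent? I = all? λ u → all? λ v → reach? ⊤ u v →-dec reach? (∁ I) u v

  small? : ∀ A → Dec (Small G A)
  small? A = allSubset? λ I → I ⊆? δ G A →-dec (bondIndependent? I →-dec ∣ I ∣ ≤? ∣ A ∣)

  ∣X∣≤∣F∩δX∣ : ∀ {F z X} → ConnectedOn G F → z ∉ X → ∣ X ∣ ≤ ∣ F ∩ δ G X ∣
  ∣X∣≤∣F∩δX∣ {F} {z} connected = go (⊂-wellFounded _)
    where
    go : ∀ {X} → Acc _⊂_ X → z ∉ X → ∣ X ∣ ≤ ∣ F ∩ δ G X ∣
    go {X} (acc smaller) z∉X with nonempty? X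
    ... | no X≡∅ = ≤-trans (≤-reflexive (trans (cong ∣_∣ (Empty-unique X≡∅)) (∣⊥∣≡0 n))) z≤n
    ... | yes (x , x∈X) with exit-edge (connected x z) x∈X z∉X
    ... | e , e∈F , a , b , a∈X , b∉X , a─b = begin
      ∣ X ∣                   ≤⟨ ∣p∣≤1+∣p-x∣ X a ⟩
      suc ∣ X - a ∣           ≤⟨ s≤s (go (smaller (x∈p⇒p-x⊂p a∈X)) (z∉X ∘ X-a⊆X)) ⟩
      suc ∣ F ∩ δ G (X - a) ∣ ≤⟨ p⊂q⇒∣p∣<∣q∣ (∩-monoʳ-⊆ F (δ-mono X-a⊆X) , e , e∈F∩δX , e∉F∩δ[X-a]) ⟩
      ∣ F ∩ δ G X ∣           ∎
      where
      open ≤-Reasoning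
      X-a⊆X : X - a ⊆ X
      X-a⊆X = p─q⊆p X ⁅ a ⁆
      e∈F∩δX : e ∈ F ∩ δ G X
      e∈F∩δX = x∈p∩q⁺ (e∈F , ∈δ⁺ {X} (joins-⊎ a─b (inj₁ a∈X)))
      e∉F∩δ[X-a] : e ∉ F ∩ δ G (X - a)
      e∉F∩δ[X-a] e∈ with joins-× {P = _∉ X - a} a─b (x∉p-x X a) (b∉X ∘ X-a⊆X)
      ... | e₁∉ , e₂∉ = Sum.[ e₁∉ , e₂∉ ] (∈δ⁻ {X - a} (proj₂ (x∈p∩q⁻ F _ e∈)))

  degree≡∑ : ∀ v → degree G v ≡ ∑[ e < m ] (χ (does (end₁ e ≟ v)) + χ (does (end₂ e ≟ v)))
  degree≡∑ v = trans (sum-map-tabulate (λ e → [_] G (isYes (end₁ e ≟ v)) + [_] G (isYes (end₂ e ≟ v))) id)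
                     (sum-cong-≗ λ e → cong₂ _+_ ([]≡χ (end₁ e ≟ v)) ([]≡χ (end₂ e ≟ v)))
    where
    []≡χ : ∀ {ℓ} {A : Set ℓ} (a? : Dec A) → [_] G (isYes a?) ≡ χ (does a?)
    []≡χ (yes _) = refl
    []≡χ (no _)  = refl

  ∑-degree : ∀ C → ∑[ v < n ] (χ (lookup C v) * degree G v) ≡ ∣ δ G C ∣ + ∣ E[ C ] ∣
  ∑-degree C = begin
    ∑[ v < n ] (χ (C∋ v) * degree G v)
      ≡⟨ sum-cong-≗ (λ v → cong (χ (C∋ v) *_) (degree≡∑ v)) ⟩
    ∑[ v < n ] (χ (C∋ v) * ∑[ e < m ] incident e v)
      ≡⟨ sum-cong-≗ (λ v → *-distribˡ-sum (χ (C∋ v)) (λ e → incident e v)) ⟩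
    ∑[ v < n ] ∑[ e < m ] (χ (C∋ v) * incident e v)
      ≡⟨ ∑-comm (λ v e → χ (C∋ v) * incident e v) ⟩
    ∑[ e < m ] ∑[ v < n ] (χ (C∋ v) * incident e v)
      ≡⟨ sum-cong-≗ ends-in-C ⟩
    ∑[ e < m ] (χ (C∋ (end₁ e)) + χ (C∋ (end₂ e)))
      ≡⟨ sum-cong-≗ (λ e → χa+χb≡χ[a∨b]+χ[a∧b] (C∋ (end₁ e)) (C∋ (end₂ e))) ⟩
    ∑[ e < m ] (χ (C∋ (end₁ e) ∨ C∋ (end₂ e)) + χ (C∋ (end₁ e) ∧ C∋ (end₂ e)))
      ≡⟨ ∑-distrib-+ (λ e → χ (C∋ (end₁ e) ∨ C∋ (end₂ e))) (λ e → χ (C∋ (end₁ e) ∧ C∋ (end₂ e))) ⟩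
    ∑[ e < m ] χ (C∋ (end₁ e) ∨ C∋ (end₂ e)) + ∑[ e < m ] χ (C∋ (end₁ e) ∧ C∋ (end₂ e))
      ≡⟨ sym (cong₂ _+_ (∣tabulate∣≡∑χ (λ e → C∋ (end₁ e) ∨ C∋ (end₂ e)))
                        (∣tabulate∣≡∑χ (λ e → C∋ (end₁ e) ∧ C∋ (end₂ e)))) ⟩
    ∣ δ G C ∣ + ∣ E[ C ] ∣ ∎
    where
    open ≡-Reasoning
    C∋ : Fin n → Bool
    C∋ = lookup C
    incident : Fin m → Fin n → ℕ
    incident e v = χ (does (end₁ e ≟ v)) + χ (does (end₂ e ≟ v))
    ends-in-C : ∀ e → ∑[ v < n ] (χ (C∋ v) * incident e v) ≡ χ (C∋ (end₁ e)) + χ (C∋ (end₂ e))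
    ends-in-C e = begin
      ∑[ v < n ] (χ (C∋ v) * incident e v)
        ≡⟨ sum-cong-≗ (λ v → *-distribˡ-+ (χ (C∋ v)) _ _) ⟩
      ∑[ v < n ] (χ (C∋ v) * χ (does (end₁ e ≟ v)) + χ (C∋ v) * χ (does (end₂ e ≟ v)))
        ≡⟨ ∑-distrib-+ (λ v → χ (C∋ v) * χ (does (end₁ e ≟ v))) (λ v → χ (C∋ v) * χ (does (end₂ e ≟ v))) ⟩
      _ ≡⟨ cong₂ _+_ (∑-select (χ ∘ C∋) (end₁ e)) (∑-select (χ ∘ C∋) (end₂ e)) ⟩
      χ (C∋ (end₁ e)) + χ (C∋ (end₂ e)) ∎

  trivalent⇒∣δ∣+∣E[]∣≡3∣C∣ : Trivalent G → ∀ C → ∣ δ G C ∣ + ∣ E[ C ] ∣ ≡ ∣ C ∣ * 3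
  trivalent⇒∣δ∣+∣E[]∣≡3∣C∣ trivalent C = begin
    ∣ δ G C ∣ + ∣ E[ C ] ∣                ≡⟨ sym (∑-degree C) ⟩
    ∑[ v < n ] (χ (lookup C v) * degree G v) ≡⟨ sum-cong-≗ (λ v → cong (χ (lookup C v) *_) (trivalent v)) ⟩
    ∑[ v < n ] (χ (lookup C v) * 3)        ≡⟨ sym (*-distribʳ-sum 3 (χ ∘ lookup C)) ⟩
    ∑[ v < n ] χ (lookup C v) * 3          ≡⟨ cong (_* 3) (sym (∣p∣≡∑χ C)) ⟩
    ∣ C ∣ * 3                              ∎
    where open ≡-Reasoning

  module _ (trivalent : Trivalent G) (connected : ConnectedOn G ⊤) where

    ∣C∣≤∣E[C]∣⇒small : ∀ {C} → Nonempty C → ∣ C ∣ ≤ ∣ E[ C ] ∣ → Small G C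
    ∣C∣≤∣E[C]∣⇒small {C} (z , z∈C) ∣C∣≤∣E[C]∣ I I⊆δC independent = by-cases (all? (_∈? C))
      where
      F : Subset m
      F = ∁ I
      F-connected : ConnectedOn G F
      F-connected u v = independent u v (connected u v)
      split : ∣ I ∣ + ∣ F ∩ δ G C ∣ ≡ ∣ δ G C ∣
      split = ⊆⇒∣p∣+∣∁p∩q∣≡∣q∣ I⊆δC
      handshake : ∣ δ G C ∣ + ∣ E[ C ] ∣ ≡ ∣ C ∣ * 3
      handshake = trivalent⇒∣δ∣+∣E[]∣≡3∣C∣ trivalent C
      open ≤-Reasoning
      by-cases : Dec (∀ v → v ∈ C) → ∣ I ∣ ≤ ∣ C ∣
      by-cases (no C≢V) with ¬∀⟶∃¬ n _ (_∈? C) C≢V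
      ... | w , w∉C = s+f+t≡3r∧r≤f∧r≤t⇒s≤r (trans (cong (_+ ∣ E[ C ] ∣) split) handshake)
                                           (∣X∣≤∣F∩δX∣ F-connected w∉C) ∣C∣≤∣E[C]∣
      by-cases (yes C≡V) =
        s+f≡d∧d+d≡3r∧r≤1+f⇒s≤r split (trans (cong (∣ δ G C ∣ +_) (sym ∣E[C]∣≡∣δC∣)) handshake) (begin
        ∣ C ∣                   ≤⟨ ∣p∣≤1+∣p-x∣ C z ⟩
        suc ∣ C - z ∣           ≤⟨ s≤s (∣X∣≤∣F∩δX∣ F-connected (x∉p-x C z)) ⟩
        suc ∣ F ∩ δ G (C - z) ∣ ≤⟨ s≤s (p⊆q⇒∣p∣≤∣q∣ (∩-monoʳ-⊆ F (δ-mono (p─q⊆p C ⁅ z ⁆)))) ⟩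
        suc ∣ F ∩ δ G C ∣       ∎)
        where
        ∣E[C]∣≡∣δC∣ : ∣ E[ C ] ∣ ≡ ∣ δ G C ∣
        ∣E[C]∣≡∣δC∣ = cong ∣_∣ (⊆-antisym (E[]⊆δ {C}) λ e∈δC → ∈E[]⁺ (C≡V _) (C≡V _))

  module _ {A : Subset n} (cycle : CycleIn G A) where

    open CycleIn cycle

    cycle-vertices : Subset n
    cycle-vertices = image vs

    cycle-vertices-nonempty : Nonempty cycle-vertices
    cycle-vertices-nonempty = vs zero , ∈-image vs zero

    cycle-vertices⊆A : cycle-vertices ⊆ A
    cycle-vertices⊆A v∈ with ∈-image⁻ vs v∈
    ... | i , refl = vs∈A i

    edge-within-cycle : ∀ {e i j} → Joins G e (vs i) (vs j) → e ∈ E[ cycle-vertices ]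
    edge-within-cycle {i = i} {j} vᵢ─vⱼ =
      uncurry (∈E[]⁺ {cycle-vertices}) (joins-× {P = _∈ cycle-vertices} vᵢ─vⱼ (∈-image vs i) (∈-image vs j))

    cycle-edges⊆E[cycle-vertices] : ∀ i → es i ∈ E[ cycle-vertices ]
    cycle-edges⊆E[cycle-vertices] i with view i
    ... | ‵fromℕ     = edge-within-cycle close
    ... | ‵inject₁ j = edge-within-cycle (joins j)

    ∣cycle-vertices∣≤∣E[cycle-vertices]∣ : ∣ cycle-vertices ∣ ≤ ∣ E[ cycle-vertices ] ∣
    ∣cycle-vertices∣≤∣E[cycle-vertices]∣ =
      ≤-trans (∣image∣≤ vs) (injective⇒≤∣p∣ es-inj cycle-edges⊆E[cycle-vertices])

lemma3p5 : (G : Graph) → Trivalent G → TwoEdgeConnected G →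
    (A : Subset (Graph.n G)) → Cyclic G A → Dependent G A
lemma3p5 G trivalent (connected , _) A cycle
  with ∃-minimal⊆ (small? G) (cycle-vertices-nonempty G cycle)
         (∣C∣≤∣E[C]∣⇒small G trivalent connected (cycle-vertices-nonempty G cycle)
                                                 (∣cycle-vertices∣≤∣E[cycle-vertices]∣ G cycle))
... | C , C⊆cycle-vertices , circuit = C , ⊆-trans C⊆cycle-vertices (cycle-vertices⊆A G cycle) , circuit
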